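{- A complete MV-algebra $A$ is coherent as a frame if and only if $A$ is finite.
   Context: An element $a$ of a complete lattice $L$ is compact if whenever $a\le\bigvee S$ for $S\subseteq L$ there is a finite $F\subseteq S$ with $a\le\bigvee F$. $L$ is compact if its top element $1$ is compact; $L$ is algebraic if each element is the join of the compact elements below it; $L$ has the finite intersection property (FIP) if the meet of any two compact elements is compact. $L$ is coherent if it is compact, algebraic and has the FIP. -}

module Defs where

open import Level using (Level; _⊔_) renaming (suc to lsuc)
open import Data.Nat using (ℕ)
open import Data.Fin using (Fin)
open import Data.List using (List; foldr)
open import Data.List.Relation.Unary.All using (All)
open import Data.Product using (Σ; ∃; ∃-syntax; _×_)
open import Function.Bundles using (_↔_)
open import Relation.Unary using (Pred)
open import Relation.Binary.PropositionalEquality using (_≡_)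

record MVAlgebra (ℓ : Level) : Set (lsuc ℓ) where
  infixl 6 _⊕_
  field
    Carrier : Set ℓ
    _⊕_     : Carrier → Carrier → Carrier
    ¬_      : Carrier → Carrier
    𝟘       : Carrier
    ⊕-assoc    : ∀ x y z → (x ⊕ y) ⊕ z ≡ x ⊕ (y ⊕ z)
    ⊕-comm     : ∀ x y → x ⊕ y ≡ y ⊕ x
    ⊕-identity : ∀ x → x ⊕ 𝟘 ≡ x
    ¬-involutive : ∀ x → ¬ (¬ x) ≡ x
    ⊕-absorb   : ∀ x → x ⊕ (¬ 𝟘) ≡ ¬ 𝟘
    mv-axiom   : ∀ x y → (¬ ((¬ x) ⊕ y)) ⊕ y ≡ (¬ ((¬ y) ⊕ x)) ⊕ x

  𝟙 : Carrier
  𝟙 = ¬ 𝟘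

  _≤_ : Carrier → Carrier → Set ℓ
  x ≤ y = (¬ x) ⊕ y ≡ 𝟙

  _∨_ : Carrier → Carrier → Carrier
  x ∨ y = (¬ ((¬ x) ⊕ y)) ⊕ y

  _∧_ : Carrier → Carrier → Carrier
  x ∧ y = ¬ ((¬ x) ∨ (¬ y))

  ⋁fin : List Carrier → Carrier
  ⋁fin = foldr _∨_ 𝟘

  IsSup : ∀ {p} → Pred Carrier p → Carrier → Set (ℓ ⊔ p)
  IsSup S s = (∀ x → S x → x ≤ s) × (∀ u → (∀ x → S x → x ≤ u) → s ≤ u)

  IsComplete : Set (lsuc ℓ)
  IsComplete = (S : Pred Carrier ℓ) → ∃[ s ] IsSup S s

  Compact : Carrier → Set (lsuc ℓ)
  Compact a = (S : Pred Carrier ℓ) (s : Carrier) → IsSup S s → a ≤ s →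
              ∃[ F ] (All S F × a ≤ ⋁fin F)

  IsCompactLattice : Set (lsuc ℓ)
  IsCompactLattice = Compact 𝟙

  IsAlgebraic : Set (lsuc ℓ)
  IsAlgebraic = ∀ a → IsSup (λ c → Compact c × c ≤ a) a

  HasFIP : Set (lsuc ℓ)
  HasFIP = ∀ a b → Compact a → Compact b → Compact (a ∧ b)

  IsCoherent : Set (lsuc ℓ)
  IsCoherent = IsCompactLattice × IsAlgebraic × HasFIP

Finite : ∀ {ℓ} → Set ℓ → Set ℓ
Finite A = ∃[ n ] (A ↔ Fin n)

-- In an MV-algebra compactness of 𝟙 spreads to every element: if s = ⋁S, then
-- 𝟙 = ⋁({¬s} ∪ {x ⊕ ¬s | x ∈ S}), and a finite subcover of 𝟙 yields one of s.
-- A complete lattice in which every element is compact has no infinite strictly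
-- monotone chains. Hence there are only finitely many atoms, the multiples n·a of
-- each atom a are eventually constant, and every x ≠ 0 lies above an atom a with
-- x ⊙ ¬a < x and x = (x ⊙ ¬a) ⊕ a; by descent every element is a finite sum of
-- multiples of atoms. Conversely, in a finite lattice every element is compact.
module Submission where

open import Defs
open import Level using (Level; _⊔_; lift; lower) renaming (suc to lsuc)
open import Axiom.ExcludedMiddle using (ExcludedMiddle)
open import Function.Base using (_∘_)
open import Function.Bundles using (_⇔_; mk⇔; mk↔ₛ′; module Inverse)
open import Data.Nat.Base as ℕ using (ℕ; zero; suc; _≤′_; ≤′-reflexive; ≤′-step; s≤s; z≤n)
open import Data.Nat.Properties using (≤⇒≤′; m≤m⊔n; m≤n⊔m; n<1+n; m<1+n⇒m<n∨m≡n)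
open import Data.Fin.Base using (Fin)
open import Data.List.Base
  using (List; []; _∷_; length; lookup; tabulate; deduplicate; filter; applyUpTo; cartesianProductWith)
open import Data.List.Relation.Unary.All as All using (All; []; _∷_)
open import Data.List.Relation.Unary.All.Properties using (all-filter)
open import Data.List.Relation.Unary.AllPairs using (_∷_)
open import Data.List.Relation.Unary.Any using (here; there; index)
open import Data.List.Relation.Unary.Any.Properties using (lookup-index)
open import Data.List.Relation.Unary.Unique.Propositional using (Unique)
open import Data.List.Relation.Unary.Unique.DecPropositional.Properties using (deduplicate-!)
open import Data.List.Membership.Propositional using (_∈_; _∉_)
open import Data.List.Membership.Propositional.Properties
  using (∈-lookup; ∈-tabulate⁺; ∈-deduplicate⁺; ∈-filter⁺; ∈-applyUpTo⁺; ∈-applyUpTo⁻;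
         ∈-cartesianProductWith⁺; ∈-cartesianProductWith⁻)
open import Data.Product using (Σ; ∃-syntax; _×_; _,_; proj₁; proj₂)
open import Data.Sum using (_⊎_; inj₁; inj₂)
open import Data.Empty using (⊥; ⊥-elim)
open import Relation.Nullary.Decidable using (Dec; yes; no; map′; decidable-stable)
open import Relation.Unary using (Pred)
open import Relation.Binary.Definitions using (DecidableEquality)
open import Relation.Binary.PropositionalEquality
  using (_≡_; _≢_; refl; sym; trans; cong; cong₂; subst; subst₂; module ≡-Reasoning)

lower-ExcludedMiddle : ∀ {a} b → ExcludedMiddle (a ⊔ b) → ExcludedMiddle a
lower-ExcludedMiddle b em = map′ lower (lift {ℓ = b}) em

module _ {a} {X : Set a} where

  index-unique : ∀ {x : X} {xs} → Unique xs → (p q : x ∈ xs) → index p ≡ index q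
  index-unique _         (here refl) (here refl) = refl
  index-unique (x∉ ∷ _)  (here refl) (there q)   = ⊥-elim (All.lookup x∉ q refl)
  index-unique (x∉ ∷ _)  (there p)   (here refl) = ⊥-elim (All.lookup x∉ p refl)
  index-unique (_ ∷ xs!) (there p)   (there q)   = cong Fin.suc (index-unique xs! p q)

  index-∈-lookup : ∀ (xs : List X) i → index (∈-lookup {xs = xs} i) ≡ i
  index-∈-lookup (_ ∷ _)  Fin.zero    = refl
  index-∈-lookup (_ ∷ xs) (Fin.suc i) = cong Fin.suc (index-∈-lookup xs i)

  enumerable⇒finite : DecidableEquality X → (xs : List X) → (∀ x → x ∈ xs) → Finite X
  enumerable⇒finite _≟_ xs xs∋ = length ys , mk↔ₛ′ to (lookup ys) to-lookup lookup-to
    where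
    ys : List X
    ys = deduplicate _≟_ xs

    ys∋ : ∀ x → x ∈ ys
    ys∋ x = ∈-deduplicate⁺ _≟_ (xs∋ x)

    to : X → Fin (length ys)
    to x = index (ys∋ x)

    lookup-to : ∀ x → lookup ys (to x) ≡ x
    lookup-to x = sym (lookup-index (ys∋ x))

    to-lookup : ∀ i → to (lookup ys i) ≡ i
    to-lookup i = trans (index-unique (deduplicate-! _≟_ xs) (ys∋ (lookup ys i)) (∈-lookup i))
                        (index-∈-lookup ys i)

  finite⇒enumerable : Finite X → Σ (List X) λ xs → ∀ x → x ∈ xs
  finite⇒enumerable (_ , X↔Fin) = tabulate from , λ x →
    subst (_∈ tabulate from) (strictlyInverseʳ x) (∈-tabulate⁺ (to x))
    where open Inverse X↔Fin

module MVAlgebraProperties {ℓ : Level} (A : MVAlgebra ℓ) where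

  open MVAlgebra A public
    renaming (_≤_ to infix 4 _≤_; _∨_ to infixr 6 _∨_; _∧_ to infixr 7 _∧_)
  open ≡-Reasoning

  infixl 7 _⊙_
  _⊙_ : Carrier → Carrier → Carrier
  x ⊙ y = ¬ (¬ x ⊕ ¬ y)

  infixr 8 _·_
  _·_ : ℕ → Carrier → Carrier
  zero  · a = 𝟘
  suc n · a = a ⊕ n · a

  infix 4 _<_
  _<_ : Carrier → Carrier → Set ℓ
  x < y = x ≤ y × x ≢ y

  Atom : Pred Carrier ℓ
  Atom a = a ≢ 𝟘 × (∀ z → z ≤ a → z ≡ 𝟘 ⊎ z ≡ a)

  ⊕-identityˡ : ∀ x → 𝟘 ⊕ x ≡ x
  ⊕-identityˡ x = trans (⊕-comm 𝟘 x) (⊕-identity x)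

  ⊕-zeroˡ : ∀ x → 𝟙 ⊕ x ≡ 𝟙
  ⊕-zeroˡ x = trans (⊕-comm 𝟙 x) (⊕-absorb x)

  ⊕-left-comm : ∀ x y z → x ⊕ (y ⊕ z) ≡ y ⊕ (x ⊕ z)
  ⊕-left-comm x y z = begin
    x ⊕ (y ⊕ z) ≡⟨ sym (⊕-assoc x y z) ⟩
    x ⊕ y ⊕ z   ≡⟨ cong (_⊕ z) (⊕-comm x y) ⟩
    y ⊕ x ⊕ z   ≡⟨ ⊕-assoc y x z ⟩
    y ⊕ (x ⊕ z) ∎

  ¬𝟙≡𝟘 : ¬ 𝟙 ≡ 𝟘
  ¬𝟙≡𝟘 = ¬-involutive 𝟘

  ¬x≡𝟙⇒x≡𝟘 : ∀ {x} → ¬ x ≡ 𝟙 → x ≡ 𝟘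
  ¬x≡𝟙⇒x≡𝟘 {x} ¬x≡𝟙 = trans (sym (¬-involutive x)) (trans (cong ¬_ ¬x≡𝟙) ¬𝟙≡𝟘)

  ¬x⊕x≡𝟙 : ∀ x → ¬ x ⊕ x ≡ 𝟙
  ¬x⊕x≡𝟙 x = begin
    ¬ x ⊕ x               ≡⟨ cong (λ t → ¬ t ⊕ x) (trans (cong (_⊕ x) ¬𝟙≡𝟘) (⊕-identityˡ x)) ⟨
    ¬ (¬ 𝟙 ⊕ x) ⊕ x       ≡⟨ mv-axiom x 𝟙 ⟨
    ¬ (¬ x ⊕ 𝟙) ⊕ 𝟙       ≡⟨ ⊕-absorb _ ⟩
    𝟙                     ∎

  x⊕¬x≡𝟙 : ∀ x → x ⊕ ¬ x ≡ 𝟙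
  x⊕¬x≡𝟙 x = trans (⊕-comm x (¬ x)) (¬x⊕x≡𝟙 x)

  ¬-⊕-⊙ : ∀ x y → ¬ (x ⊕ y) ≡ ¬ x ⊙ ¬ y
  ¬-⊕-⊙ x y = sym (cong ¬_ (cong₂ _⊕_ (¬-involutive x) (¬-involutive y)))

  ≤-refl : ∀ {x} → x ≤ x
  ≤-refl {x} = ¬x⊕x≡𝟙 x

  ∨-comm : ∀ x y → x ∨ y ≡ y ∨ x
  ∨-comm = mv-axiom

  ≤⇒∨≡ : ∀ {x y} → x ≤ y → x ∨ y ≡ y
  ≤⇒∨≡ {x} {y} x≤y = trans (cong (λ t → ¬ t ⊕ y) x≤y) (trans (cong (_⊕ y) ¬𝟙≡𝟘) (⊕-identityˡ y))

  ≤-antisym : ∀ {x y} → x ≤ y → y ≤ x → x ≡ y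
  ≤-antisym {x} {y} x≤y y≤x = trans (sym (≤⇒∨≡ y≤x)) (trans (∨-comm y x) (≤⇒∨≡ x≤y))

  x≤y⇒x≤z⊕y : ∀ {x y} z → x ≤ y → x ≤ z ⊕ y
  x≤y⇒x≤z⊕y {x} {y} z x≤y = begin
    ¬ x ⊕ (z ⊕ y) ≡⟨ ⊕-left-comm (¬ x) z y ⟩
    z ⊕ (¬ x ⊕ y) ≡⟨ cong (z ⊕_) x≤y ⟩
    z ⊕ 𝟙         ≡⟨ ⊕-absorb z ⟩
    𝟙             ∎

  x≤y⊕x : ∀ {x y} → x ≤ y ⊕ x
  x≤y⊕x {y = y} = x≤y⇒x≤z⊕y y ≤-refl

  x≤x⊕y : ∀ {x y} → x ≤ x ⊕ y
  x≤x⊕y {x} {y} = subst (x ≤_) (⊕-comm y x) x≤y⊕x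

  -- In MV-algebras, y ⊙ ¬x is the difference y ⊖ x; adding x back gives y ∨ x.
  ⊙¬-⊕-cancel : ∀ {x y} → x ≤ y → y ⊙ ¬ x ⊕ x ≡ y
  ⊙¬-⊕-cancel {x} {y} x≤y = begin
    ¬ (¬ y ⊕ ¬ ¬ x) ⊕ x ≡⟨ cong (λ t → ¬ (¬ y ⊕ t) ⊕ x) (¬-involutive x) ⟩
    y ∨ x               ≡⟨ ∨-comm y x ⟩
    x ∨ y               ≡⟨ ≤⇒∨≡ x≤y ⟩
    y                   ∎

  ≤-trans : ∀ {x y z} → x ≤ y → y ≤ z → x ≤ z
  ≤-trans {x} {y} {z} x≤y y≤z = subst (x ≤_) (⊙¬-⊕-cancel y≤z) (x≤y⇒x≤z⊕y (z ⊙ ¬ y) x≤y)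

  ⊕-monoˡ-≤ : ∀ {x y} z → x ≤ y → x ⊕ z ≤ y ⊕ z
  ⊕-monoˡ-≤ {x} {y} z x≤y = subst (x ⊕ z ≤_) y⊖x⊕x⊕z≡y⊕z x≤y⊕x
    where
    y⊖x⊕x⊕z≡y⊕z : y ⊙ ¬ x ⊕ (x ⊕ z) ≡ y ⊕ z
    y⊖x⊕x⊕z≡y⊕z = trans (sym (⊕-assoc _ x z)) (cong (_⊕ z) (⊙¬-⊕-cancel x≤y))

  ¬-mono-≤ : ∀ {x y} → x ≤ y → ¬ y ≤ ¬ x
  ¬-mono-≤ {x} {y} x≤y = trans (cong (_⊕ ¬ x) (¬-involutive y)) (trans (⊕-comm y (¬ x)) x≤y)

  ¬-cancel-≤ : ∀ {x y} → ¬ y ≤ ¬ x → x ≤ y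
  ¬-cancel-≤ ¬y≤¬x = subst₂ _≤_ (¬-involutive _) (¬-involutive _) (¬-mono-≤ ¬y≤¬x)

  ⊙-monoˡ-≤ : ∀ {x y} z → x ≤ y → x ⊙ z ≤ y ⊙ z
  ⊙-monoˡ-≤ z x≤y = ¬-mono-≤ (⊕-monoˡ-≤ (¬ z) (¬-mono-≤ x≤y))

  x⊙y≤x : ∀ {x y} → x ⊙ y ≤ x
  x⊙y≤x = ¬-cancel-≤ (subst (_ ≤_) (sym (¬-involutive _)) x≤x⊕y)

  x⊙y≤y : ∀ {x y} → x ⊙ y ≤ y
  x⊙y≤y {x} {y} = subst (_≤ y) (cong ¬_ (⊕-comm (¬ y) (¬ x))) x⊙y≤x

  x≤¬y⊕z⇒x⊙y≤z : ∀ {x y z} → x ≤ ¬ y ⊕ z → x ⊙ y ≤ z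
  x≤¬y⊕z⇒x⊙y≤z {x} {y} {z} x≤¬y⊕z =
    trans (cong (_⊕ z) (¬-involutive _)) (trans (⊕-assoc (¬ x) (¬ y) z) x≤¬y⊕z)

  x⊙¬y≡𝟘⇒x≤y : ∀ {x y} → x ⊙ ¬ y ≡ 𝟘 → x ≤ y
  x⊙¬y≡𝟘⇒x≤y {x} {y} x⊙¬y≡𝟘 = begin
    ¬ x ⊕ y         ≡⟨ cong (¬ x ⊕_) (¬-involutive y) ⟨
    ¬ x ⊕ ¬ ¬ y     ≡⟨ ¬-involutive _ ⟨
    ¬ (x ⊙ ¬ y)     ≡⟨ cong ¬_ x⊙¬y≡𝟘 ⟩
    𝟙               ∎

  ⊕¬-⊙-cancel : ∀ {x y} → x ≤ y → (x ⊕ ¬ y) ⊙ y ≡ x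
  ⊕¬-⊙-cancel {x} {y} x≤y = begin
    ¬ (¬ (x ⊕ ¬ y) ⊕ ¬ y)    ≡⟨ cong (λ t → ¬ (t ⊕ ¬ y)) (¬-⊕-⊙ x (¬ y)) ⟩
    ¬ (¬ x ⊙ ¬ ¬ y ⊕ ¬ y)    ≡⟨ cong ¬_ (⊙¬-⊕-cancel (¬-mono-≤ x≤y)) ⟩
    ¬ ¬ x                    ≡⟨ ¬-involutive x ⟩
    x                        ∎

  𝟘≤x : ∀ {x} → 𝟘 ≤ x
  𝟘≤x {x} = ⊕-zeroˡ x

  x≤𝟘⇒x≡𝟘 : ∀ {x} → x ≤ 𝟘 → x ≡ 𝟘
  x≤𝟘⇒x≡𝟘 {x} x≤𝟘 = ¬x≡𝟙⇒x≡𝟘 (trans (sym (⊕-identity (¬ x))) x≤𝟘)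

  𝟙≤x⇒x≡𝟙 : ∀ {x} → 𝟙 ≤ x → x ≡ 𝟙
  𝟙≤x⇒x≡𝟙 {x} 𝟙≤x = trans (sym (⊕-identityˡ x)) (trans (cong (_⊕ x) (sym ¬𝟙≡𝟘)) 𝟙≤x)

  x≤y∨x : ∀ {x y} → x ≤ y ∨ x
  x≤y∨x = x≤y⊕x

  x≤x∨y : ∀ {x y} → x ≤ x ∨ y
  x≤x∨y {x} {y} = subst (x ≤_) (∨-comm y x) x≤y∨x

  ∨-least : ∀ {x y z} → x ≤ z → y ≤ z → x ∨ y ≤ z
  ∨-least {x} {y} {z} x≤z y≤z =
    subst (x ∨ y ≤_) (trans (∨-comm z y) (≤⇒∨≡ y≤z))
      (⊕-monoˡ-≤ y (¬-mono-≤ (⊕-monoˡ-≤ y (¬-mono-≤ x≤z))))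

  ≤∨⇒⊙¬≤ : ∀ {x y z} → x ≤ y ∨ z → x ⊙ ¬ z ≤ y
  ≤∨⇒⊙¬≤ {x} {y} {z} x≤y∨z = ≤-trans (x≤¬y⊕z⇒x⊙y≤z x≤¬¬z⊕w) w≤y
    where
    w : Carrier
    w = ¬ (¬ y ⊕ z)

    x≤¬¬z⊕w : x ≤ ¬ ¬ z ⊕ w
    x≤¬¬z⊕w = subst (x ≤_) (trans (⊕-comm w z) (cong (_⊕ w) (sym (¬-involutive z)))) x≤y∨z

    w≤y : w ≤ y
    w≤y = subst (w ≤_) (¬-involutive y) (¬-mono-≤ x≤x⊕y)

  ⊙¬-< : ∀ {a y} → a ≢ 𝟘 → a ≤ y → y ⊙ ¬ a < y
  ⊙¬-< {a} {y} a≢𝟘 a≤y = x⊙y≤x , λ y⊖a≡y → a≢𝟘 (¬x≡𝟙⇒x≡𝟘 (¬a≡𝟙 y⊖a≡y))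
    where
    ¬a≡𝟙 : y ⊙ ¬ a ≡ y → ¬ a ≡ 𝟙
    ¬a≡𝟙 y⊖a≡y = begin
      ¬ a                 ≡⟨ trans (∨-comm (¬ a) y) (≤⇒∨≡ y≤¬a) ⟨
      ¬ a ∨ y             ≡⟨ cong (λ t → ¬ (t ⊕ y) ⊕ y) (¬-involutive a) ⟩
      ¬ (a ⊕ y) ⊕ y       ≡⟨ cong (λ t → ¬ t ⊕ y) (trans (⊕-comm a y) y⊕a≡y) ⟩
      ¬ y ⊕ y             ≡⟨ ¬x⊕x≡𝟙 y ⟩
      𝟙                   ∎
      where
      y⊕a≡y : y ⊕ a ≡ y
      y⊕a≡y = trans (cong (_⊕ a) (sym y⊖a≡y)) (⊙¬-⊕-cancel a≤y)
      y≤¬a : y ≤ ¬ a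
      y≤¬a = subst (_≤ ¬ a) y⊖a≡y x⊙y≤y

  x∈xs⇒x≤⋁fin : ∀ {x xs} → x ∈ xs → x ≤ ⋁fin xs
  x∈xs⇒x≤⋁fin (here refl) = x≤x∨y
  x∈xs⇒x≤⋁fin (there x∈xs) = ≤-trans (x∈xs⇒x≤⋁fin x∈xs) x≤y∨x

  increasing⇒monotone : (f : ℕ → Carrier) → (∀ n → f n ≤ f (suc n)) →
                        ∀ {m n} → m ℕ.≤ n → f m ≤ f n
  increasing⇒monotone f f↑ {m} m≤n = go (≤⇒≤′ m≤n)
    where
    go : ∀ {n} → m ≤′ n → f m ≤ f n
    go (≤′-reflexive refl) = ≤-refl
    go (≤′-step m≤′n)      = ≤-trans (go m≤′n) (f↑ _)

  atom-prime : ∀ {c y z} → Atom c → c ≤ y ∨ z → (c ≤ y → ⊥) → c ≤ z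
  atom-prime {c} {y} {z} (_ , c-atomic) c≤y∨z c≰y with c-atomic (c ⊙ ¬ z) x⊙y≤x
  ... | inj₁ c⊙¬z≡𝟘 = x⊙¬y≡𝟘⇒x≤y c⊙¬z≡𝟘
  ... | inj₂ c⊙¬z≡c = ⊥-elim (c≰y (subst (_≤ y) c⊙¬z≡c (≤∨⇒⊙¬≤ c≤y∨z)))

  all-compact⇒coherent : (∀ a → Compact a) → IsCoherent
  all-compact⇒coherent compact =
    compact 𝟙 , (λ a → (λ _ → proj₂) , λ u u-ub → u-ub a (compact a , ≤-refl)) , λ a b _ _ → compact (a ∧ b)

module _ {ℓ : Level} (A : MVAlgebra ℓ) (complete : MVAlgebra.IsComplete A) where

  open MVAlgebraProperties A

  shifted : Pred Carrier ℓ → Carrier → Pred Carrier ℓ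
  shifted S s y = y ≡ ¬ s ⊎ ∃[ x ] (S x × y ≡ x ⊕ ¬ s)

  shifted-ub⇒𝟙≤ : ∀ {S s u} → IsSup S s → (∀ y → shifted S s y → y ≤ u) → 𝟙 ≤ u
  shifted-ub⇒𝟙≤ {S} {s} {u} (s-ub , s-least) u-ub =
    subst₂ _≤_ (x⊕¬x≡𝟙 s) u⊙s⊕¬s≡u (⊕-monoˡ-≤ (¬ s) s≤u⊙s)
    where
    u⊙s⊕¬s≡u : u ⊙ s ⊕ ¬ s ≡ u
    u⊙s⊕¬s≡u = trans (cong (λ t → u ⊙ t ⊕ ¬ s) (sym (¬-involutive s)))
                     (⊙¬-⊕-cancel (u-ub (¬ s) (inj₁ refl)))

    x≤u⊙s : ∀ x → S x → x ≤ u ⊙ s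
    x≤u⊙s x Sx = subst (_≤ u ⊙ s) (⊕¬-⊙-cancel (s-ub x Sx))
                       (⊙-monoˡ-≤ s (u-ub (x ⊕ ¬ s) (inj₂ (x , Sx , refl))))

    s≤u⊙s : s ≤ u ⊙ s
    s≤u⊙s = s-least (u ⊙ s) x≤u⊙s

  ⋁fin-shifted : ∀ {S s} ys → All (shifted S s) ys →
                 Σ (List Carrier) λ xs → All S xs × ⋁fin ys ≤ ⋁fin xs ⊕ ¬ s
  ⋁fin-shifted [] [] = [] , [] , 𝟘≤x
  ⋁fin-shifted (_ ∷ ys) (inj₁ refl ∷ ys-shifted) =
    let (xs , xs⊆S , ⋁ys≤) = ⋁fin-shifted ys ys-shifted
    in xs , xs⊆S , ∨-least x≤y⊕x ⋁ys≤
  ⋁fin-shifted {s = s} (_ ∷ ys) (inj₂ (x , Sx , refl) ∷ ys-shifted) =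
    let (xs , xs⊆S , ⋁ys≤) = ⋁fin-shifted ys ys-shifted
    in x ∷ xs , Sx ∷ xs⊆S , ∨-least (⊕-monoˡ-≤ (¬ s) x≤x∨y) (≤-trans ⋁ys≤ (⊕-monoˡ-≤ (¬ s) x≤y∨x))

  compact-top⇒compact : IsCompactLattice → ∀ a → Compact a
  compact-top⇒compact compact-𝟙 a S s s-sup a≤s =
    let (σ , σ-sup) = complete (shifted S s)
        (ys , ys-shifted , 𝟙≤⋁ys) = compact-𝟙 (shifted S s) σ σ-sup (shifted-ub⇒𝟙≤ s-sup (proj₁ σ-sup))
        (xs , xs⊆S , ⋁ys≤) = ⋁fin-shifted ys ys-shifted
        s≤⋁xs = trans (⊕-comm (¬ s) _) (𝟙≤x⇒x≡𝟙 (≤-trans 𝟙≤⋁ys ⋁ys≤))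
    in xs , xs⊆S , ≤-trans a≤s s≤⋁xs

module _ {ℓ : Level} (A : MVAlgebra ℓ) (complete : MVAlgebra.IsComplete A)
         (compact : ∀ a → MVAlgebra.Compact A a) where

  open MVAlgebraProperties A

  ascending-chain-stabilises : (f : ℕ → Carrier) → (∀ n → f n ≤ f (suc n)) →
                               ∃[ n ] f (suc n) ≤ f n
  ascending-chain-stabilises f f↑ =
    let (s , s-ub , s-least) = complete range
        (xs , xs⊆range , s≤⋁xs) = compact s range s (s-ub , s-least) ≤-refl
        (n , ⋁xs≤fn) = bounded xs xs⊆range
    in n , ≤-trans (s-ub (f (suc n)) (suc n , refl)) (≤-trans s≤⋁xs ⋁xs≤fn)
    where
    range : Pred Carrier ℓ
    range y = ∃[ n ] f n ≡ y

    bounded : ∀ xs → All range xs → ∃[ n ] ⋁fin xs ≤ f n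
    bounded [] [] = 0 , 𝟘≤x
    bounded (_ ∷ xs) ((m , refl) ∷ xs⊆range) =
      let (n , ⋁xs≤fn) = bounded xs xs⊆range
          f-mono = increasing⇒monotone f f↑
      in m ℕ.⊔ n , ∨-least (f-mono (m≤m⊔n m n)) (≤-trans ⋁xs≤fn (f-mono (m≤n⊔m m n)))

  descending-chain-stabilises : (f : ℕ → Carrier) → (∀ n → f (suc n) ≤ f n) →
                                ∃[ n ] f n ≤ f (suc n)
  descending-chain-stabilises f f↓ =
    let (n , ¬fsn≤¬fn) = ascending-chain-stabilises (¬_ ∘ f) (¬-mono-≤ ∘ f↓)
    in n , ¬-cancel-≤ ¬fsn≤¬fn

  no-infinite-descent : (P : Pred Carrier ℓ) → (∀ x → P x → ∃[ y ] (P y × y < x)) →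
                        ∀ x → P x → ⊥
  no-infinite-descent P descend x Px =
    let (n , fn≤fsn) = descending-chain-stabilises f (proj₁ ∘ f↓)
    in proj₂ (f↓ n) (≤-antisym (proj₁ (f↓ n)) fn≤fsn)
    where
    next : Σ Carrier P → Σ Carrier P
    next (y , Py) = let (z , Pz , _) = descend y Py in z , Pz

    chain : ℕ → Σ Carrier P
    chain zero    = x , Px
    chain (suc n) = next (chain n)

    f : ℕ → Carrier
    f = proj₁ ∘ chain

    f↓ : ∀ n → f (suc n) < f n
    f↓ n = proj₂ (proj₂ (descend (f n) (proj₂ (chain n))))

  ord : Carrier → ℕ
  ord a = proj₁ (ascending-chain-stabilises (_· a) (λ _ → x≤y⊕x))

  ord-stable : ∀ a → suc (ord a) · a ≡ ord a · a
  ord-stable a = ≤-antisym (proj₂ (ascending-chain-stabilises (_· a) (λ _ → x≤y⊕x))) x≤y⊕x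

  multiples : Carrier → List Carrier
  multiples a = applyUpTo (_· a) (suc (ord a))

  𝟘∈multiples : ∀ a → 𝟘 ∈ multiples a
  𝟘∈multiples a = ∈-applyUpTo⁺ (_· a) (s≤s z≤n)

  multiples-⊕-closed : ∀ {a m} → m ∈ multiples a → a ⊕ m ∈ multiples a
  multiples-⊕-closed {a} m∈ with ∈-applyUpTo⁻ (_· a) m∈
  ... | k , k≤ord , refl with m<1+n⇒m<n∨m≡n k≤ord
  ...   | inj₁ k<ord = ∈-applyUpTo⁺ (_· a) (s≤s k<ord)
  ...   | inj₂ refl  = subst (_∈ multiples a) (sym (ord-stable a)) (∈-applyUpTo⁺ (_· a) (n<1+n _))

  sums : List Carrier → List Carrier
  sums []       = 𝟘 ∷ []
  sums (a ∷ as) = cartesianProductWith _⊕_ (multiples a) (sums as)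

  𝟘∈sums : ∀ as → 𝟘 ∈ sums as
  𝟘∈sums []       = here refl
  𝟘∈sums (a ∷ as) = subst (_∈ sums (a ∷ as)) (⊕-identity 𝟘)
    (∈-cartesianProductWith⁺ _⊕_ (𝟘∈multiples a) (𝟘∈sums as))

  sums-⊕-closed : ∀ {b x} as → b ∈ as → x ∈ sums as → b ⊕ x ∈ sums as
  sums-⊕-closed (a ∷ as) b∈ x∈ with ∈-cartesianProductWith⁻ _⊕_ (multiples a) (sums as) x∈
  sums-⊕-closed (a ∷ as) (here refl) _ | m , y , m∈ , y∈ , refl =
    subst (_∈ sums (a ∷ as)) (⊕-assoc a m y)
      (∈-cartesianProductWith⁺ _⊕_ (multiples-⊕-closed m∈) y∈)
  sums-⊕-closed {b} (a ∷ as) (there b∈) _ | m , y , m∈ , y∈ , refl =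
    subst (_∈ sums (a ∷ as)) (⊕-left-comm m b y)
      (∈-cartesianProductWith⁺ _⊕_ m∈ (sums-⊕-closed as b∈ y∈))

  module _ (lem : ExcludedMiddle (lsuc ℓ)) where

    excluded-middle : ExcludedMiddle ℓ
    excluded-middle = lower-ExcludedMiddle (lsuc ℓ) lem

    atom≤⋁fin⇒∈ : ∀ {c as} → All Atom as → Atom c → c ≤ ⋁fin as → c ∈ as
    atom≤⋁fin⇒∈ [] (c≢𝟘 , _) c≤𝟘 = ⊥-elim (c≢𝟘 (x≤𝟘⇒x≡𝟘 c≤𝟘))
    atom≤⋁fin⇒∈ {c} {a ∷ _} ((_ , a-atomic) ∷ as-atoms) c-atom c≤a∨⋁as
      with excluded-middle {c ≤ a}
    ... | no c≰a = there (atom≤⋁fin⇒∈ as-atoms c-atom (atom-prime c-atom c≤a∨⋁as c≰a))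
    ... | yes c≤a with a-atomic c c≤a
    ...   | inj₁ c≡𝟘 = ⊥-elim (proj₁ c-atom c≡𝟘)
    ...   | inj₂ c≡a = here c≡a

    atoms-enumerable : Σ (List Carrier) λ as → ∀ a → Atom a → a ∈ as
    atoms-enumerable =
      let (s , s-ub , s-least) = complete Atom
          (as , as-atoms , s≤⋁as) = compact s Atom s (s-ub , s-least) ≤-refl
      in as , λ c c-atom → atom≤⋁fin⇒∈ as-atoms c-atom (≤-trans (s-ub c c-atom) s≤⋁as)

    non-atom-has-smaller : ∀ {x} → x ≢ 𝟘 → (Atom x → ⊥) → ∃[ z ] (z ≢ 𝟘 × z < x)
    non-atom-has-smaller {x} x≢𝟘 x-not-atom =
      decidable-stable excluded-middle λ ∄z → x-not-atom (x≢𝟘 , atomic ∄z)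
      where
      atomic : (∃[ z ] (z ≢ 𝟘 × z < x) → ⊥) → ∀ z → z ≤ x → z ≡ 𝟘 ⊎ z ≡ x
      atomic ∄z z z≤x with excluded-middle {z ≡ 𝟘}
      ... | yes z≡𝟘 = inj₁ z≡𝟘
      ... | no z≢𝟘  = inj₂ (decidable-stable excluded-middle λ z≢x → ∄z (z , z≢𝟘 , z≤x , z≢x))

    atom-below : ∀ x → x ≢ 𝟘 → ∃[ a ] (Atom a × a ≤ x)
    atom-below x x≢𝟘 =
      decidable-stable excluded-middle λ ∄a → no-infinite-descent P descend x (x≢𝟘 , ∄a)
      where
      P : Pred Carrier ℓ
      P y = y ≢ 𝟘 × (∃[ a ] (Atom a × a ≤ y) → ⊥)

      descend : ∀ y → P y → ∃[ z ] (P z × z < y)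
      descend y (y≢𝟘 , ∄a) =
        let (z , z≢𝟘 , z<y) = non-atom-has-smaller y≢𝟘 λ y-atom → ∄a (y , y-atom , ≤-refl)
        in z , (z≢𝟘 , λ (a , a-atom , a≤z) → ∄a (a , a-atom , ≤-trans a≤z (proj₁ z<y))) , z<y

    elements : List Carrier
    elements = sums (proj₁ atoms-enumerable)

    elements-enumerates : ∀ x → x ∈ elements
    elements-enumerates x =
      decidable-stable excluded-middle (no-infinite-descent (_∉ elements) descend x)
      where
      descend : ∀ y → y ∉ elements → ∃[ z ] (z ∉ elements × z < y)
      descend y y∉ =
        let (a , a-atom , a≤y) = atom-below y y≢𝟘
            a⊕[y⊖a]≡y = trans (⊕-comm a _) (⊙¬-⊕-cancel a≤y)
            a∈atoms = proj₂ atoms-enumerable a a-atom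
        in y ⊙ ¬ a ,
           (λ y⊖a∈ → y∉ (subst (_∈ elements) a⊕[y⊖a]≡y (sums-⊕-closed _ a∈atoms y⊖a∈))) ,
           ⊙¬-< (proj₁ a-atom) a≤y
        where
        y≢𝟘 : y ≢ 𝟘
        y≢𝟘 y≡𝟘 = y∉ (subst (_∈ elements) (sym y≡𝟘) (𝟘∈sums (proj₁ atoms-enumerable)))

    all-compact⇒finite : Finite Carrier
    all-compact⇒finite = enumerable⇒finite (λ _ _ → excluded-middle) elements elements-enumerates

module _ {ℓ : Level} (lem : ExcludedMiddle (lsuc ℓ)) (A : MVAlgebra ℓ) where

  open MVAlgebraProperties A

  enumerable⇒all-compact : ∀ {xs} → (∀ x → x ∈ xs) → ∀ a → Compact a
  enumerable⇒all-compact {xs} xs∋ a S s (_ , s-least) a≤s =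
    filter S? xs , all-filter S? xs ,
    ≤-trans a≤s (s-least _ λ x Sx → x∈xs⇒x≤⋁fin (∈-filter⁺ S? (xs∋ x) Sx))
    where
    S? : ∀ x → Dec (S x)
    S? x = lower-ExcludedMiddle (lsuc ℓ) lem

corollary2p10 : ∀ {ℓ : Level} → ExcludedMiddle (lsuc ℓ) → (A : MVAlgebra ℓ) →
                  MVAlgebra.IsComplete A →
                  (MVAlgebra.IsCoherent A ⇔ Finite (MVAlgebra.Carrier A))
corollary2p10 lem A complete = mk⇔ coherent⇒finite finite⇒coherent
  where
  coherent⇒finite : MVAlgebra.IsCoherent A → Finite (MVAlgebra.Carrier A)
  coherent⇒finite (compact-𝟙 , _) =
    all-compact⇒finite A complete (compact-top⇒compact A complete compact-𝟙) lem

  finite⇒coherent : Finite (MVAlgebra.Carrier A) → MVAlgebra.IsCoherent A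
  finite⇒coherent finite =
    MVAlgebraProperties.all-compact⇒coherent A
      (enumerable⇒all-compact lem A (proj₂ (finite⇒enumerable finite)))
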